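{- For any recursion variable $X$, trace formula $\Phi$, valuation $\mathbb{V}$, and procedure contract $(pre, post)$: if the validity of $(pre, post)$ for $X$ in $\mathbb{V}$ implies its validity for $\Phi$ in $\mathbb{V}$, then $(pre,post)$ is also valid for $\mu X. \Phi$ in $\mathbb{V}$.
   Context: Trace formulas are generated by $\Phi ::= p \mid R \mid \Phi \land \Phi \mid \Phi \lor \Phi \mid \Phi \frown \Phi \mid X \mid \mu X.\Phi$ ($p$ first-order state predicates, $R$ binary state relations, $X$ recursion variables, $\frown$ chop). Under a valuation $\mathbb{V}$ mapping recursion variables to sets of finite non-empty traces, $[\![p]\!]_{\mathbb{V}} = \{s\cdot\sigma \mid s\models p\}$, $[\![R]\!]_{\mathbb{V}}=\{s\cdot s' \mid R(s,s')\}$, $\land/\lor$ are intersection/union, $[\![\Phi_1\frown\Phi_2]\!]_{\mathbb{V}} = \{\sigma\cdot s\cdot\sigma' \mid \sigma\cdot s\in[\![\Phi_1]\!]_{\mathbb{V}},\ s\cdot\sigma'\in[\![\Phi_2]\!]_{\mathbb{V}}\}$, $[\![X]\!]_{\mathbb{V}}=\mathbb{V}(X)$, and $[\![\mu X.\Phi]\!]_{\mathbb{V}}$ is the least fixed point of $\gamma\mapsto[\![\Phi]\!]_{\mathbb{V}[X\mapsto\gamma]}$. A procedure contract is a pair $(pre,post)$ of state predicates, where $post$ may mention fresh variables $v_{old}$ holding the values of $v$ before evaluation. With $(v^i)$ all program variables occurring in $\Phi$ and $(v^i_{old})$ fresh, $(pre,post)$ is valid for $\Phi$ in $\mathbb{V}$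 iff $[\![\bigwedge_i v_{old}^i = v^i \land pre \land \Phi \frown true]\!]_{\mathbb{V}} \subseteq [\![\Phi \frown post]\!]_{\mathbb{V}}$.
   Formalization: The premise holds for every set γ of traces: validity of (pre, post) for X in 𝕍[X↦γ] implies its validity for Φ in 𝕍[X↦γ], and the variables vⁱ form one arbitrary list shared by X, Φ and μX.Φ. Apart from conventions, each condition added here is assumed in the paper as well or is needed for the statement above to hold. -}

module Defs where

open import Data.Nat using (ℕ; zero; suc; _≟_)
open import Data.Integer using (ℤ)
open import Data.List using (List; []; _∷_)
open import Data.List.NonEmpty using (List⁺; _∷_; head; _∷ʳ_; _++⁺_)
open import Data.List.Relation.Unary.All using (All)
open import Data.Product using (Σ; _×_; _,_; ∃)
open import Data.Sum using (_⊎_)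
open import Data.Unit using (⊤)
open import Data.Empty using (⊥)
open import Relation.Binary.PropositionalEquality using (_≡_)
open import Relation.Nullary using (yes; no)

-- Program variables are named by natural numbers; for every program
-- variable v there is a distinct (fresh) variable v_old.
data PVar : Set where
  prog : ℕ → PVar
  old  : ℕ → PVar

State : Set
State = PVar → ℤ

Trace : Set
Trace = List⁺ State

TraceSet : Set₁
TraceSet = Trace → Set

StatePred : Set₁
StatePred = State → Set

StateRel : Set₁
StateRel = State → State → Set

RVar : Set
RVar = ℕ

infixr 6 _∧ᶠ_
infixr 5 _∨ᶠ_
infixr 7 _⌢_

data Formula : Set₁ where
  pred  : StatePred → Formula
  rel   : StateRel → Formula
  _∧ᶠ_  : Formula → Formula → Formula
  _∨ᶠ_  : Formula → Formula → Formula
  _⌢_   : Formula → Formula → Formula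
  var   : RVar → Formula
  μ     : RVar → Formula → Formula

Valuation : Set₁
Valuation = RVar → TraceSet

_[_↦_] : Valuation → RVar → TraceSet → Valuation
(V [ X ↦ γ ]) Y with X ≟ Y
... | yes _ = γ
... | no  _ = V Y

-- Semantics.  The least fixed point of the (monotone, ω-continuous)
-- operator γ ↦ ⟦Φ⟧ V[X ↦ γ] is given by its Kleene iteration
-- ⋃ₙ Fⁿ(∅).

mutual
  ⟦_⟧ : Formula → Valuation → TraceSet
  ⟦ pred p ⟧ V τ = p (head τ)
  ⟦ rel R ⟧ V τ = Σ State λ s → Σ State λ s' → τ ≡ (s ∷ s' ∷ []) × R s s'
  ⟦ Φ₁ ∧ᶠ Φ₂ ⟧ V τ = ⟦ Φ₁ ⟧ V τ × ⟦ Φ₂ ⟧ V τ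
  ⟦ Φ₁ ∨ᶠ Φ₂ ⟧ V τ = ⟦ Φ₁ ⟧ V τ ⊎ ⟦ Φ₂ ⟧ V τ
  ⟦ Φ₁ ⌢ Φ₂ ⟧ V τ =
    Σ (List State) λ σ → Σ State λ s → Σ (List State) λ σ' →
      τ ≡ (σ ++⁺ (s ∷ σ')) × ⟦ Φ₁ ⟧ V (σ ∷ʳ s) × ⟦ Φ₂ ⟧ V (s ∷ σ')
  ⟦ var X ⟧ V τ = V X τ
  ⟦ μ X Φ ⟧ V τ = Σ ℕ λ n → approx Φ V X n τ

  approx : Formula → Valuation → RVar → ℕ → TraceSet
  approx Φ V X zero    τ = ⊥
  approx Φ V X (suc n) τ = ⟦ Φ ⟧ (V [ X ↦ approx Φ V X n ]) τ

trueᶠ : Formula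
trueᶠ = pred (λ _ → ⊤)

OldEq : List ℕ → StatePred
OldEq vs s = All (λ v → s (old v) ≡ s (prog v)) vs

-- (pre , post) is valid for Φ in V, where vs lists the program variables
-- (vᵢ) of Φ:
--   ⟦ ⋀ᵢ vᵢ_old = vᵢ ∧ pre ∧ Φ ⌢ true ⟧_V ⊆ ⟦ Φ ⌢ post ⟧_V
ValidContract : List ℕ → StatePred → StatePred → Formula → Valuation → Set
ValidContract vs pre post Φ V =
  ∀ τ → ⟦ pred (OldEq vs) ∧ᶠ pred pre ∧ᶠ (Φ ⌢ trueᶠ) ⟧ V τ
      → ⟦ Φ ⌢ pred post ⟧ V τ

{-# OPTIONS --safe #-}
-- The least fixed point of γ ↦ ⟦Φ⟧ V[X ↦ γ] is the union of its Kleene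
-- approximants.  Validity of a contract depends on a formula only through its
-- denotation, holds vacuously for the empty approximant, is propagated from one
-- approximant to the next by the hypothesis, and is preserved under unions.
module Submission where

open import Defs
open import Data.Nat using (ℕ; zero; suc; _≟_)
open import Data.List using (List)
open import Data.List.NonEmpty using (head; _∷_; _∷ʳ_; _++⁺_)
open import Data.Product using (Σ; _×_; _,_)
open import Data.Unit using (⊤)
open import Data.Empty using (⊥; ⊥-elim)
open import Relation.Binary.PropositionalEquality using (_≡_; refl; sym; subst)
open import Relation.Nullary using (yes; no)

Chop : TraceSet → TraceSet → TraceSet
Chop A B τ =
  Σ (List State) λ σ → Σ State λ s → Σ (List State) λ σ' →
    τ ≡ (σ ++⁺ (s ∷ σ')) × A (σ ∷ʳ s) × B (s ∷ σ')

-- ValidContract vs pre post Φ V unfolds definitionally to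
-- ValidOn vs pre post (⟦ Φ ⟧ V).
ValidOn : List ℕ → StatePred → StatePred → TraceSet → Set
ValidOn vs pre post A =
  ∀ τ → OldEq vs (head τ) × pre (head τ) × Chop A (λ _ → ⊤) τ
      → Chop A (λ τ′ → post (head τ′)) τ

validOn-∅ : ∀ {vs pre post} → ValidOn vs pre post (λ _ → ⊥)
validOn-∅ τ (_ , _ , _ , _ , _ , _ , () , _)

validOn-⋃ : ∀ {vs pre post} {I : Set} (A : I → TraceSet) →
  (∀ i → ValidOn vs pre post (A i)) →
  ValidOn vs pre post (λ τ → Σ I λ i → A i τ)
validOn-⋃ A valid τ (oe , pr , σ , s , σ' , eq , (i , a) , t)
  with valid i τ (oe , pr , σ , s , σ' , eq , a , t)
... | σ₂ , s₂ , σ₂' , eq₂ , a₂ , p₂ = σ₂ , s₂ , σ₂' , eq₂ , (i , a₂) , p₂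

[↦]-lookup : ∀ V X γ → (V [ X ↦ γ ]) X ≡ γ
[↦]-lookup V X γ with X ≟ X
... | yes _ = refl
... | no X≢X = ⊥-elim (X≢X refl)

theorem4 : (vs : List ℕ) (X : RVar) (Φ : Formula) (V : Valuation)
    (pre post : StatePred) →
    ((γ : TraceSet) → ValidContract vs pre post (var X) (V [ X ↦ γ ])
                    → ValidContract vs pre post Φ (V [ X ↦ γ ])) →
    ValidContract vs pre post (μ X Φ) V
theorem4 vs X Φ V pre post step = validOn-⋃ (approx Φ V X) approx-valid
  where
  approx-valid : ∀ n → ValidOn vs pre post (approx Φ V X n)
  approx-valid zero    = validOn-∅
  approx-valid (suc n) = step γ (subst (ValidOn vs pre post) (sym ([↦]-lookup V X γ)) (approx-valid n))
    where γ = approx Φ V X n
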